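{- Suppose $\mathbf{Q}(x)\in\mathfrak{Q}$. Then $\widehat{\mathbf{Q}}(x)\in\mathsf{RT}_1$.
   Context: $\mathsf{RT}_1$ is the set of $\mathbf{R}(x)=\sum r(n)x^n\in\mathbb{R}[[x]]$ with $r(n)>0$ for all sufficiently large $n$ and $\lim_{n\to\infty}r(n-1)/r(n)=1$; $\mathsf{RTN}_1=\mathsf{RT}_1\cap\mathbb{N}[[x]]$. $\mathfrak{Q}=\{x^{\mathfrak{c}}\mathbf{R}(x^{\mathfrak{d}})\in x\cdot\mathbb{N}[[x]]:\mathfrak{c},\mathfrak{d}\in\mathbb{N},\ \mathbf{R}(x)\in\mathsf{RTN}_1,\ 0\le\mathfrak{c}<\mathfrak{d}\}$. For a power series $\mathbf{Q}(x)$ with $\mathbf{Q}(0)=0$, its star transform is $\mathbf{Q}^\star(x)=\sum_{m\ge1}\mathbf{Q}(x^m)/m$, and $\widehat{\mathbf{Q}}(x)=\frac{x}{1-x}\cdot\frac{d}{dx}\mathbf{Q}^\star(x)$. -}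

module Defs where

open import Data.Nat as ℕ using (ℕ; zero; suc; _∸_; _≤?_; _≤_)
open import Data.Nat.DivMod using (_/_; _%_)
open import Data.Rational as ℚ using (ℚ; 0ℚ; 1ℚ; _+_; _*_; _-_; _÷_; ∣_∣; _<_; ≢-nonZero)
open import Data.Rational using (_≟_)
import Data.Rational as Q
open import Data.Integer using (+_)
open import Data.Product using (Σ; ∃; _×_)
open import Relation.Nullary using (yes; no)
open import Relation.Binary.PropositionalEquality using (_≡_)

-- Formal power series, represented by their coefficient sequences.
Series : Set
Series = ℕ → ℚ

NSeries : Set
NSeries = ℕ → ℕ

toℚSeries : NSeries → Series
toℚSeries a n = (+ a n) Q./ 1

-- total division on ℚ (value at q = 0 is irrelevant, only used where q > 0 eventually)
_⊘_ : ℚ → ℚ → ℚ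
p ⊘ q with q ≟ 0ℚ
... | yes _ = 0ℚ
... | no q≢0 = _÷_ p q {{≢-nonZero q≢0}}

ConvergesTo : (ℕ → ℚ) → ℚ → Set
ConvergesTo a L = ∀ (ε : ℚ) → 0ℚ < ε → ∃ λ N → ∀ n → N ≤ n → ∣ a n - L ∣ < ε

RT₁ : Series → Set
RT₁ r = (∃ λ N → ∀ n → N ≤ n → 0ℚ < r n)
      × ConvergesTo (λ n → r (n ∸ 1) ⊘ r n) 1ℚ

RTN₁ : NSeries → Set
RTN₁ r = RT₁ (toℚSeries r)

-- coefficients of x^c · R(x^d)  (for d = 0 we return 0; this case is excluded by c < d)
monoSubst : ℕ → ℕ → NSeries → NSeries
monoSubst c zero R n = 0
monoSubst c (suc d) R n with c ≤? n | (n ∸ c) % suc d ℕ.≟ 0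
... | yes _ | yes _ = R ((n ∸ c) / suc d)
... | _     | _     = 0

In𝔔 : NSeries → Set
In𝔔 Q = Q 0 ≡ 0 × Σ ℕ λ c → Σ ℕ λ d → Σ NSeries λ R →
          RTN₁ R × c ℕ.< d × (∀ n → Q n ≡ monoSubst c d R n)

sumBelow : ℕ → (ℕ → ℚ) → ℚ
sumBelow zero f = 0ℚ
sumBelow (suc n) f = sumBelow n f + f n

-- star transform: coefficient of x^k in Σ_{m≥1} Q(x^m)/m is Σ_{m ∣ k} q(k/m)/m
-- (for k ≥ 1 only m ≤ k can divide k; the constant term is 0 since Q(0) = 0)
starCoeffTerm : NSeries → ℕ → ℕ → ℚ
starCoeffTerm Q k m with k % suc m ℕ.≟ 0
... | yes _ = (+ Q (k / suc m)) Q./ suc m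
... | no _  = 0ℚ

star : NSeries → Series
star Q zero = 0ℚ
star Q (suc k) = sumBelow (suc k) (starCoeffTerm Q (suc k))

deriv : Series → Series
deriv a n = ((+ suc n) Q./ 1) * a (suc n)

mulXOver1-X : Series → Series
mulXOver1-X a n = sumBelow n a

hat : NSeries → Series
hat Q = mulXOver1-X (deriv (star Q))

module Submission where

-- Write g t = t·q(t) for the coefficients q of Q.  The n-th coefficient of
-- x·(Q⋆)' is the divisor sum a n = Σ_{e ∣ n} g(n/e), so Q̂ has the natural
-- coefficients H n = a 1 + … + a n.  As H n - H(n-1) = a n, Q̂ ∈ RT₁ follows
-- once a n = o(H n) (negligible-increments⇒RT₁).  Regrouping by divisors gives
-- H n = Σ_{m<n} S ⌊n/(m+1)⌋ with S u = g 1 + … + g u, from which a = o(H)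
-- follows as soon as g t = o(S t) and H n / n → ∞ (divSum-negligible).  For
-- Q = x^c R(x^D) both come from R(n-1)/R(n) → 1: R varies by at most a factor 2
-- on windows of fixed length (SlowVariation), so g t is at most four times each
-- of the L preceding nonzero values of g, giving g = o(S); and g t ≥ t on the
-- progression c + Dℕ makes H superlinear (Progression).

open import Data.Nat as ℕ using (ℕ; zero; suc)
open import Data.Product using (∃; _,_)
open import Relation.Binary.PropositionalEquality using (_≡_; refl)
open import Defs

Eventually : (ℕ → Set) → Set
Eventually P = ∃ λ N → ∀ n → N ℕ.≤ n → P n

-- limsup R(n)/R(n-1) ≤ 1, stated in ℕ: for every M, eventually M·R(n) ≤ (M+1)·R(n-1).
RatioBounded : (ℕ → ℕ) → Set
RatioBounded R = ∀ M → Eventually (λ n → M ℕ.* R n ℕ.≤ suc M ℕ.* R (n ℕ.∸ 1))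

module NaturalSums where

  open import Data.Nat
  open import Data.Nat.Properties
  open import Relation.Binary.PropositionalEquality
  open import Algebra.Properties.CommutativeSemigroup +-commutativeSemigroup using (interchange)

  Σ< : ℕ → (ℕ → ℕ) → ℕ
  Σ< zero    f = 0
  Σ< (suc n) f = Σ< n f + f n

  Σ-cong : ∀ n {f g} → (∀ i → f i ≡ g i) → Σ< n f ≡ Σ< n g
  Σ-cong zero    f≡g = refl
  Σ-cong (suc n) f≡g = cong₂ _+_ (Σ-cong n f≡g) (f≡g n)

  Σ-mono : ∀ n {f g} → (∀ i → i < n → f i ≤ g i) → Σ< n f ≤ Σ< n g
  Σ-mono zero    f≤g = z≤n
  Σ-mono (suc n) f≤g = +-mono-≤ (Σ-mono n (λ i i<n → f≤g i (m<n⇒m<1+n i<n))) (f≤g n (n<1+n n))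

  Σ-+ : ∀ n f g → Σ< n (λ i → f i + g i) ≡ Σ< n f + Σ< n g
  Σ-+ zero    f g = refl
  Σ-+ (suc n) f g = trans (cong (_+ (f n + g n)) (Σ-+ n f g))
                          (interchange (Σ< n f) (Σ< n g) (f n) (g n))

  Σ-const : ∀ n x → Σ< n (λ _ → x) ≡ n * x
  Σ-const zero    x = refl
  Σ-const (suc n) x = trans (cong (_+ x) (Σ-const n x)) (+-comm (n * x) x)

  Σ-*ˡ : ∀ n k f → Σ< n (λ i → k * f i) ≡ k * Σ< n f
  Σ-*ˡ zero    k f = sym (*-zeroʳ k)
  Σ-*ˡ (suc n) k f = trans (cong (_+ k * f n) (Σ-*ˡ n k f))
                           (sym (*-distribˡ-+ k (Σ< n f) (f n)))

  Σ-unshift : ∀ n f → Σ< (suc n) f ≡ f 0 + Σ< n (λ i → f (suc i))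
  Σ-unshift zero    f = sym (+-identityʳ (f 0))
  Σ-unshift (suc n) f = trans (cong (_+ f (suc n)) (Σ-unshift n f))
                              (+-assoc (f 0) _ (f (suc n)))

  Σ-monoᵇ : ∀ f {m n} → m ≤ n → Σ< m f ≤ Σ< n f
  Σ-monoᵇ f m≤n = go (≤⇒≤′ m≤n)
    where
    go : ∀ {m n} → m ≤′ n → Σ< m f ≤ Σ< n f
    go ≤′-refl       = ≤-refl
    go (≤′-step m≤n) = ≤-trans (go m≤n) (m≤m+n _ _)

module HalvingArithmetic where

  open import Data.Nat
  open import Data.Nat.Properties
  open import Relation.Binary.PropositionalEquality using (sym; cong)

  m≤2*[m∸n] : ∀ m n → n + n ≤ m → m ≤ 2 * (m ∸ n)
  m≤2*[m∸n] m n 2n≤m = begin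
    m                 ≡⟨ sym (m∸n+n≡m n≤m) ⟩
    (m ∸ n) + n       ≤⟨ +-monoʳ-≤ (m ∸ n) n≤m∸n ⟩
    (m ∸ n) + (m ∸ n) ≡⟨ cong ((m ∸ n) +_) (sym (+-identityʳ (m ∸ n))) ⟩
    2 * (m ∸ n)       ∎
    where
    open ≤-Reasoning
    n≤m : n ≤ m
    n≤m = ≤-trans (m≤m+n n n) 2n≤m
    n≤m∸n : n ≤ m ∸ n
    n≤m∸n = ≤-trans (≤-reflexive (sym (m+n∸m≡n n n))) (∸-monoˡ-≤ n 2n≤m)

module FloorDivision where

  open import Data.Nat
  open import Data.Nat.Properties
  open import Data.Nat.DivMod
  open import Data.Product using (_×_; _,_; proj₁; proj₂)
  open import Data.Sum using (_⊎_; inj₁; inj₂)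
  open import Relation.Nullary using (yes; no)
  open import Relation.Binary.PropositionalEquality

  divMod-unique : ∀ {n} r q d .{{_ : NonZero d}} → r < d → n ≡ r + q * d →
                  n / d ≡ q × n % d ≡ r
  divMod-unique r q d r<d refl = quotient , remainder
    where
    remainder : (r + q * d) % d ≡ r
    remainder = trans ([m+kn]%n≡m%n r q d) (m<n⇒m%n≡m r<d)
    quotient : (r + q * d) / d ≡ q
    quotient = begin
      (r + q * d) / d   ≡⟨ +-distrib-/ r (q * d) (subst (_< d) (sym r%d+0≡r) r<d) ⟩
      r / d + q * d / d ≡⟨ cong₂ _+_ (m<n⇒m/n≡0 r<d) (m*n/n≡m q d) ⟩
      q                 ∎
      where
      open ≡-Reasoning
      r%d+0≡r : r % d + q * d % d ≡ r
      r%d+0≡r = trans (cong₂ _+_ (m<n⇒m%n≡m r<d) (m*n%n≡0 q d)) (+-identityʳ r)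

  floor-step : ∀ n d .{{_ : NonZero d}} →
               (suc n % d ≡ 0 × suc n / d ≡ suc (n / d)) ⊎ (suc n % d ≢ 0 × suc n / d ≡ n / d)
  floor-step n d with suc (n % d) <? d
  ... | yes r+1<d = inj₂ (r+1≢0 , proj₁ same-quotient)
    where
    same-quotient : suc n / d ≡ n / d × suc n % d ≡ suc (n % d)
    same-quotient = divMod-unique (suc (n % d)) (n / d) d r+1<d (cong suc (m≡m%n+[m/n]*n n d))
    r+1≢0 : suc n % d ≢ 0
    r+1≢0 eq = 0≢1+n (trans (sym eq) (proj₂ same-quotient))
  ... | no r+1≮d = inj₁ (proj₂ next-quotient , proj₁ next-quotient)
    where
    r+1≡d : suc (n % d) ≡ d
    r+1≡d = ≤-antisym (m%n<n n d) (≮⇒≥ r+1≮d)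
    next-quotient : suc n / d ≡ suc (n / d) × suc n % d ≡ 0
    next-quotient = divMod-unique 0 (suc (n / d)) d (subst (0 <_) r+1≡d (s≤s z≤n))
                      (trans (cong suc (m≡m%n+[m/n]*n n d)) (cong (_+ (n / d) * d) r+1≡d))

-- The coefficients attached to a series Q = Σ q(t) xᵗ with natural coefficients:
-- g t = t·q(t), the divisor sums a n = divSum n = Σ_{e ∣ n} g(n/e) (n times the
-- n-th coefficient of Q⋆), the partial sums S u = partialSum u = g 1 + … + g u,
-- and H n = cumSum n = a 1 + … + a n (the n-th coefficient of Q̂).
module StarCoefficients (Q : ℕ → ℕ) where

  open import Data.Nat
  open import Data.Nat.Properties
  open import Data.Nat.DivMod
  open import Data.Product using (∃; _×_; _,_; proj₁; proj₂)
  open import Data.Sum using (inj₁; inj₂)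
  open import Data.Empty using (⊥-elim)
  open import Relation.Nullary using (yes; no)
  open import Relation.Binary.PropositionalEquality
  open import Data.Nat.Solver using (module +-*-Solver)
  open +-*-Solver
  open NaturalSums
  open FloorDivision

  g : ℕ → ℕ
  g t = t * Q t

  divTerm : ℕ → ℕ → ℕ
  divTerm k m with k % suc m ≟ 0
  ... | yes _ = g (k / suc m)
  ... | no  _ = 0

  divSum : ℕ → ℕ
  divSum n = Σ< n (divTerm n)

  partialSum : ℕ → ℕ
  partialSum u = Σ< u (λ i → g (suc i))

  cumSum : ℕ → ℕ
  cumSum n = Σ< n (λ k → divSum (suc k))

  divTerm-divisor : ∀ k m → k % suc m ≡ 0 → divTerm k m ≡ g (k / suc m)
  divTerm-divisor k m divides with k % suc m ≟ 0
  ... | yes _        = refl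
  ... | no  ¬divides = ⊥-elim (¬divides divides)

  divTerm-nondivisor : ∀ k m → k % suc m ≢ 0 → divTerm k m ≡ 0
  divTerm-nondivisor k m ¬divides with k % suc m ≟ 0
  ... | yes divides = ⊥-elim (¬divides divides)
  ... | no  _       = refl

  divTerm≤g : ∀ k m → divTerm k m ≤ g (k / suc m)
  divTerm≤g k m with k % suc m ≟ 0
  ... | yes _ = ≤-refl
  ... | no  _ = z≤n

  g≤partialSum : ∀ u → g u ≤ partialSum u
  g≤partialSum zero    = z≤n
  g≤partialSum (suc u) = m≤n+m (g (suc u)) (partialSum u)

  partialSum-mono : ∀ {u v} → u ≤ v → partialSum u ≤ partialSum v
  partialSum-mono = Σ-monoᵇ _

  partialSum-floor-step : ∀ n m →
    partialSum (suc n / suc m) ≡ partialSum (n / suc m) + divTerm (suc n) m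
  partialSum-floor-step n m with floor-step n (suc m)
  ... | inj₁ (divides , next) rewrite divTerm-divisor (suc n) m divides | next = refl
  ... | inj₂ (¬divides , same) rewrite divTerm-nondivisor (suc n) m ¬divides | same =
    sym (+-identityʳ _)

  cumSum-by-divisors : ∀ n → cumSum n ≡ Σ< n (λ m → partialSum (n / suc m))
  cumSum-by-divisors zero    = refl
  cumSum-by-divisors (suc n) = begin
    cumSum n + divSum (suc n)
      ≡⟨ cong (_+ divSum (suc n)) (cumSum-by-divisors n) ⟩
    Σ< n (λ m → partialSum (n / suc m)) + divSum (suc n)
      ≡⟨ cong (λ x → x + divSum (suc n)) (sym (+-identityʳ (Σ< n (λ m → partialSum (n / suc m))))) ⟩
    Σ< n (λ m → partialSum (n / suc m)) + 0 + divSum (suc n)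
      ≡⟨ cong (λ x → Σ< n (λ m → partialSum (n / suc m)) + partialSum x + divSum (suc n))
              (sym (m<n⇒m/n≡0 (n<1+n n))) ⟩
    Σ< (suc n) (λ m → partialSum (n / suc m)) + divSum (suc n)
      ≡⟨ sym (Σ-+ (suc n) (λ m → partialSum (n / suc m)) (divTerm (suc n))) ⟩
    Σ< (suc n) (λ m → partialSum (n / suc m) + divTerm (suc n) m)
      ≡⟨ sym (Σ-cong (suc n) (partialSum-floor-step n)) ⟩
    Σ< (suc n) (λ m → partialSum (suc n / suc m)) ∎
    where open ≡-Reasoning

  -- The divisor m = 0 alone contributes S n to H n.
  partialSum≤cumSum : ∀ n → partialSum n ≤ cumSum n
  partialSum≤cumSum zero    = z≤n
  partialSum≤cumSum (suc n) = begin
    partialSum (suc n)                             ≡⟨ cong partialSum (sym (n/1≡n (suc n))) ⟩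
    partialSum (suc n / 1)                         ≤⟨ Σ-monoᵇ (λ m → partialSum (suc n / suc m)) (s≤s (z≤n {n})) ⟩
    Σ< (suc n) (λ m → partialSum (suc n / suc m))  ≡⟨ sym (cumSum-by-divisors (suc n)) ⟩
    cumSum (suc n)                                 ∎
    where open ≤-Reasoning

  -- If g t is eventually negligible against S t and H grows faster than linearly,
  -- then a n is eventually negligible against H n: in H n = Σ_m S ⌊n/(m+1)⌋ the
  -- large quotients dominate their divisor terms and the small ones cost O(n).
  divSum-negligible :
    (∀ K → Eventually (λ t → K * g t ≤ partialSum t)) →
    (∀ B → Eventually (λ n → B * n < cumSum n)) →
    ∀ K → Eventually (λ n → K * divSum n < cumSum n)
  divSum-negligible g-negligible H-superlinear K = N , a-negligible
    where
    T : ℕ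
    T = proj₁ (g-negligible (2 * K))
    B : ℕ
    B = 2 * K * partialSum T
    N : ℕ
    N = proj₁ (H-superlinear B)

    term-bound : ∀ n m → 2 * K * divTerm n m ≤ partialSum (n / suc m) + B
    term-bound n m with T ≤? n / suc m
    ... | yes T≤q = begin
      2 * K * divTerm n m        ≤⟨ *-monoʳ-≤ (2 * K) (divTerm≤g n m) ⟩
      2 * K * g (n / suc m)      ≤⟨ proj₂ (g-negligible (2 * K)) (n / suc m) T≤q ⟩
      partialSum (n / suc m)     ≤⟨ m≤m+n _ B ⟩
      partialSum (n / suc m) + B ∎
      where open ≤-Reasoning
    ... | no T≰q = begin
      2 * K * divTerm n m        ≤⟨ *-monoʳ-≤ (2 * K) (divTerm≤g n m) ⟩
      2 * K * g (n / suc m)      ≤⟨ *-monoʳ-≤ (2 * K) (g≤partialSum (n / suc m)) ⟩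
      2 * K * partialSum (n / suc m) ≤⟨ *-monoʳ-≤ (2 * K) (partialSum-mono (<⇒≤ (≰⇒> T≰q))) ⟩
      B                          ≤⟨ m≤n+m B _ ⟩
      partialSum (n / suc m) + B ∎
      where open ≤-Reasoning

    sum-bound : ∀ n → 2 * K * divSum n ≤ cumSum n + n * B
    sum-bound n = begin
      2 * K * divSum n                                           ≡⟨ sym (Σ-*ˡ n (2 * K) (divTerm n)) ⟩
      Σ< n (λ m → 2 * K * divTerm n m)                           ≤⟨ Σ-mono n (λ m _ → term-bound n m) ⟩
      Σ< n (λ m → partialSum (n / suc m) + B)                    ≡⟨ Σ-+ n _ _ ⟩
      Σ< n (λ m → partialSum (n / suc m)) + Σ< n (λ _ → B)       ≡⟨ cong₂ _+_ (sym (cumSum-by-divisors n)) (Σ-const n B) ⟩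
      cumSum n + n * B                                           ∎
      where open ≤-Reasoning

    a-negligible : ∀ n → N ≤ n → K * divSum n < cumSum n
    a-negligible n N≤n = *-cancelˡ-< 2 _ _ (begin-strict
      2 * (K * divSum n) ≡⟨ sym (*-assoc 2 K (divSum n)) ⟩
      2 * K * divSum n   ≤⟨ sum-bound n ⟩
      cumSum n + n * B   ≡⟨ cong (cumSum n +_) (*-comm n B) ⟩
      cumSum n + B * n   <⟨ +-monoʳ-< (cumSum n) (proj₂ (H-superlinear B) n N≤n) ⟩
      cumSum n + cumSum n ≡⟨ cong (cumSum n +_) (sym (+-identityʳ (cumSum n))) ⟩
      2 * cumSum n       ∎)
      where open ≤-Reasoning

  progressionSum≤partialSum : ∀ d L t → suc d * L ≤ t →
    Σ< L (λ j → g (t ∸ suc d * j)) ≤ partialSum t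
  progressionSum≤partialSum d zero    t         DL≤t = z≤n
  progressionSum≤partialSum d (suc L) zero      DL≤t with () ← ≤-trans (≤-reflexive (sym (*-suc (suc d) L))) DL≤t
  progressionSum≤partialSum d (suc L) (suc t) DL≤t = begin
    Σ< (suc L) (λ j → g (suc t ∸ D * j))
      ≡⟨ Σ-unshift L (λ j → g (suc t ∸ D * j)) ⟩
    g (suc t ∸ D * 0) + Σ< L (λ j → g (suc t ∸ D * suc j))
      ≡⟨ cong₂ _+_ (cong (λ x → g (suc t ∸ x)) (*-zeroʳ D)) (Σ-cong L shift) ⟩
    g (suc t) + Σ< L (λ j → g (suc t ∸ D ∸ D * j))
      ≤⟨ +-monoʳ-≤ (g (suc t)) (progressionSum≤partialSum d L (suc t ∸ D) DL≤t-D) ⟩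
    g (suc t) + partialSum (suc t ∸ D)
      ≤⟨ +-monoʳ-≤ (g (suc t)) (partialSum-mono (∸-monoʳ-≤ (suc t) (s≤s (z≤n {d})))) ⟩
    g (suc t) + partialSum t
      ≡⟨ +-comm (g (suc t)) (partialSum t) ⟩
    partialSum (suc t) ∎
    where
    open ≤-Reasoning
    D : ℕ
    D = suc d
    shift : ∀ j → g (suc t ∸ D * suc j) ≡ g (suc t ∸ D ∸ D * j)
    shift j = cong g (trans (cong (suc t ∸_) (*-suc D j)) (sym (∸-+-assoc (suc t) D (D * j))))
    DL≤t-D : D * L ≤ suc t ∸ D
    DL≤t-D = begin
      D * L             ≡⟨ sym (m+n∸m≡n D (D * L)) ⟩
      D + D * L ∸ D     ≤⟨ ∸-monoˡ-≤ D (≤-trans (≤-reflexive (sym (*-suc D L))) DL≤t) ⟩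
      suc t ∸ D         ∎

  cumSum-superlinear :
    (∀ K → Eventually (λ t → K * g t ≤ partialSum t)) →
    (∀ T → Eventually (λ n → ∃ λ t → T ≤ t × t ≤ n × n ≤ t + t × t ≤ g t)) →
    ∀ B → Eventually (λ n → B * n < cumSum n)
  cumSum-superlinear g-negligible dense-support B = N , H-large
    where
    K : ℕ
    K = suc (2 * B)
    T : ℕ
    T = proj₁ (g-negligible K)
    N : ℕ
    N = proj₁ (dense-support (suc T))
    H-large : ∀ n → N ≤ n → B * n < cumSum n
    H-large n N≤n with proj₂ (dense-support (suc T)) n N≤n
    ... | t , T<t , t≤n , n≤2t , t≤gt = begin-strict
      B * n            ≤⟨ *-monoʳ-≤ B n≤2t ⟩
      B * (t + t)      ≡⟨ solve 2 (λ B t → B :* (t :+ t) := (con 2 :* B) :* t) refl B t ⟩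
      2 * B * t        <⟨ m<n+m (2 * B * t) (≤-trans (s≤s z≤n) T<t) ⟩
      K * t            ≤⟨ *-monoʳ-≤ K t≤gt ⟩
      K * g t          ≤⟨ proj₂ (g-negligible K) t (≤-trans (n≤1+n T) T<t) ⟩
      partialSum t     ≤⟨ partialSum-mono t≤n ⟩
      partialSum n     ≤⟨ partialSum≤cumSum n ⟩
      cumSum n         ∎
      where open ≤-Reasoning

module SlowVariation (R : ℕ → ℕ) (ratio-bound : RatioBounded R) where

  open import Data.Nat
  open import Data.Nat.Properties
  open import Data.Product using (_,_; proj₁; proj₂)
  open import Relation.Binary.PropositionalEquality
  open import Data.Nat.Solver using (module +-*-Solver)
  open +-*-Solver
  open HalvingArithmetic

  -- Telescoping the ratio bound j times: if k + j = M + 1 then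
  -- k·R(s) ≤ (M+1)·R(s - j), because the factors k/(k+1), (k+1)/(k+2), … cancel.
  telescope : ∀ M N → (∀ n → N ≤ n → M * R n ≤ suc M * R (n ∸ 1)) →
              ∀ j k s → k + j ≡ suc M → N + j ≤ s → k * R s ≤ suc M * R (s ∸ j)
  telescope M N bound zero    k s k≡M+1 _ rewrite +-identityʳ k | k≡M+1 = ≤-refl
  telescope M N bound (suc j) k s k+j+1≡M+1 N+j+1≤s = *-cancelˡ-≤ (suc M) (begin
      suc M * (k * R s)            ≡⟨ sym (*-assoc (suc M) k (R s)) ⟩
      (suc M * k) * R s            ≤⟨ *-monoˡ-≤ (R s) factor ⟩
      (M * suc k) * R s            ≡⟨ *-assoc M (suc k) (R s) ⟩
      M * (suc k * R s)            ≤⟨ *-monoʳ-≤ M shorter ⟩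
      M * (suc M * R (s ∸ j))      ≡⟨ solve 3 (λ a b x → a :* (b :* x) := b :* (a :* x)) refl M (suc M) (R (s ∸ j)) ⟩
      suc M * (M * R (s ∸ j))      ≤⟨ *-monoʳ-≤ (suc M) last-step ⟩
      suc M * (suc M * R (s ∸ suc j)) ∎)
    where
    open ≤-Reasoning
    M≡k+j : M ≡ k + j
    M≡k+j = suc-injective (trans (sym k+j+1≡M+1) (+-suc k j))
    factor : suc M * k ≤ M * suc k
    factor rewrite *-suc M k = +-monoˡ-≤ (M * k) (≤-trans (m≤m+n k j) (≤-reflexive (sym M≡k+j)))
    shorter : suc k * R s ≤ suc M * R (s ∸ j)
    shorter = telescope M N bound j (suc k) s (trans (sym (+-suc k j)) k+j+1≡M+1)
                (≤-trans (+-monoʳ-≤ N (n≤1+n j)) N+j+1≤s)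
    N≤s∸j : N ≤ s ∸ j
    N≤s∸j = begin
      N            ≡⟨ sym (m+n∸n≡m N j) ⟩
      N + j ∸ j    ≤⟨ ∸-monoˡ-≤ j (≤-trans (+-monoʳ-≤ N (n≤1+n j)) N+j+1≤s) ⟩
      s ∸ j        ∎
    last-step : M * R (s ∸ j) ≤ suc M * R (s ∸ suc j)
    last-step = subst (λ x → M * R (s ∸ j) ≤ suc M * R x)
                  (trans (∸-+-assoc s j 1) (cong (s ∸_) (+-comm j 1)))
                  (bound (s ∸ j) N≤s∸j)

  window-bound : ∀ L → Eventually (λ s → ∀ j → j < L → R s ≤ 2 * R (s ∸ j))
  window-bound L = N + L , doubling
    where
    M : ℕ
    M = L + L + 1
    N : ℕ
    N = proj₁ (ratio-bound M)
    doubling : ∀ s → N + L ≤ s → ∀ j → j < L → R s ≤ 2 * R (s ∸ j)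
    doubling s N+L≤s j j<L = *-cancelˡ-≤ (suc M) (begin
      suc M * R s                ≤⟨ *-monoˡ-≤ (R s) (m≤2*[m∸n] (suc M) j 2j≤M+1) ⟩
      (2 * (suc M ∸ j)) * R s    ≡⟨ *-assoc 2 (suc M ∸ j) (R s) ⟩
      2 * ((suc M ∸ j) * R s)    ≤⟨ *-monoʳ-≤ 2 telescoped ⟩
      2 * (suc M * R (s ∸ j))    ≡⟨ solve 2 (λ a x → con 2 :* (a :* x) := a :* (con 2 :* x)) refl (suc M) (R (s ∸ j)) ⟩
      suc M * (2 * R (s ∸ j))    ∎)
      where
      open ≤-Reasoning
      2j≤M+1 : j + j ≤ suc M
      2j≤M+1 = ≤-trans (+-mono-≤ (<⇒≤ j<L) (<⇒≤ j<L)) (≤-trans (m≤m+n (L + L) 1) (n≤1+n M))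
      telescoped : (suc M ∸ j) * R s ≤ suc M * R (s ∸ j)
      telescoped = telescope M N (proj₂ (ratio-bound M)) j (suc M ∸ j) s
                     (m∸n+n≡m (≤-trans (m≤n+m j j) 2j≤M+1))
                     (≤-trans (+-monoʳ-≤ N (<⇒≤ j<L)) N+L≤s)

module Progression (c d : ℕ) (R Q : ℕ → ℕ) (Q≡ : ∀ n → Q n ≡ monoSubst c (suc d) R n)
  (R-positive : Eventually (λ s → 1 ℕ.≤ R s)) (ratio-bound : RatioBounded R) where

  open import Data.Nat
  open import Data.Nat.Properties
  open import Data.Nat.DivMod
  open import Data.Nat.Divisibility using (m%n≡0⇒n∣m)
  open import Data.Product using (∃; _×_; _,_; proj₁; proj₂)
  open import Data.Sum using (_⊎_; inj₁; inj₂)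
  open import Data.Empty using (⊥-elim)
  open import Relation.Nullary using (yes; no)
  open import Relation.Binary.PropositionalEquality
  open import Data.Nat.Solver using (module +-*-Solver)
  open +-*-Solver
  open NaturalSums
  open HalvingArithmetic
  open StarCoefficients Q
  open SlowVariation R ratio-bound

  D : ℕ
  D = suc d

  Q-on-progression : ∀ s → Q (c + D * s) ≡ R s
  Q-on-progression s = trans (Q≡ (c + D * s)) monoSubst-value
    where
    shift : c + D * s ∸ c ≡ s * D
    shift = trans (m+n∸m≡n c (D * s)) (*-comm D s)
    monoSubst-value : monoSubst c D R (c + D * s) ≡ R s
    monoSubst-value with c ≤? c + D * s | (c + D * s ∸ c) % D ≟ 0
    ... | yes _   | yes _     = cong R (trans (cong (_/ D) shift) (m*n/n≡m s D))
    ... | yes _   | no  D∤Ds = ⊥-elim (D∤Ds (trans (cong (_% D) shift) (m*n%n≡0 s D)))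
    ... | no  c≰t | _         = ⊥-elim (c≰t (m≤m+n c (D * s)))

  Q-off-progression : ∀ t → Q t ≡ 0 ⊎ ∃ λ s → t ≡ c + D * s
  Q-off-progression t with c ≤? t | (t ∸ c) % D ≟ 0 | Q≡ t
  ... | yes c≤t | yes D∣t∸c | _ =
    inj₂ ((t ∸ c) / D , sym (trans (cong (c +_) (m*[n/m]≡n (m%n≡0⇒n∣m (t ∸ c) D D∣t∸c))) (m+[n∸m]≡n c≤t)))
  ... | yes _   | no  _     | Qt≡0 = inj₁ Qt≡0
  ... | no  _   | _         | Qt≡0 = inj₁ Qt≡0

  step-back : ∀ s j → j ≤ s → c + D * s ∸ D * j ≡ c + D * (s ∸ j)
  step-back s j j≤s = trans (+-∸-assoc c (*-monoʳ-≤ D j≤s)) (cong (c +_) (sym (*-distribˡ-∸ D s j)))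

  -- Far out, g changes by at most a factor 4 over L steps back along the progression:
  -- the position halves at most and R halves at most (window-bound).
  g-window-bound : ∀ L → Eventually (λ s → ∀ j → j < L → g (c + D * s) ≤ 4 * g (c + D * (s ∸ j)))
  g-window-bound L = N + (L + L) , comparable
    where
    N : ℕ
    N = proj₁ (window-bound L)
    comparable : ∀ s → N + (L + L) ≤ s → ∀ j → j < L → g (c + D * s) ≤ 4 * g (c + D * (s ∸ j))
    comparable s N+2L≤s j j<L = begin
      g (c + D * s)                                    ≡⟨ cong ((c + D * s) *_) (Q-on-progression s) ⟩
      (c + D * s) * R s                                ≤⟨ *-mono-≤ position-halves R-halves ⟩
      (2 * (c + D * (s ∸ j))) * (2 * R (s ∸ j))        ≡⟨ solve 2 (λ x y → (con 2 :* x) :* (con 2 :* y) := con 4 :* (x :* y)) refl (c + D * (s ∸ j)) (R (s ∸ j)) ⟩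
      4 * ((c + D * (s ∸ j)) * R (s ∸ j))              ≡⟨ cong (λ x → 4 * ((c + D * (s ∸ j)) * x)) (sym (Q-on-progression (s ∸ j))) ⟩
      4 * g (c + D * (s ∸ j))                          ∎
      where
      open ≤-Reasoning
      2j≤s : j + j ≤ s
      2j≤s = ≤-trans (+-mono-≤ (<⇒≤ j<L) (<⇒≤ j<L)) (≤-trans (m≤n+m (L + L) N) N+2L≤s)
      R-halves : R s ≤ 2 * R (s ∸ j)
      R-halves = proj₂ (window-bound L) s (≤-trans (m≤m+n N (L + L)) N+2L≤s) j j<L
      position-halves : c + D * s ≤ 2 * (c + D * (s ∸ j))
      position-halves = begin
        c + D * s                      ≤⟨ +-monoʳ-≤ c (*-monoʳ-≤ D (m≤2*[m∸n] s j 2j≤s)) ⟩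
        c + D * (2 * (s ∸ j))          ≤⟨ +-monoˡ-≤ (D * (2 * (s ∸ j))) (m≤m+n c (c + 0)) ⟩
        2 * c + D * (2 * (s ∸ j))      ≡⟨ solve 3 (λ c D x → con 2 :* c :+ D :* (con 2 :* x) := con 2 :* (c :+ D :* x)) refl c D (s ∸ j) ⟩
        2 * (c + D * (s ∸ j))          ∎

  -- g t is negligible against S t: on the progression, L·g t is at most four
  -- times the sum of the L preceding progression terms, all of them part of S t.
  g-negligible : ∀ K → Eventually (λ t → K * g t ≤ partialSum t)
  g-negligible K = c + D * M , negligible
    where
    L : ℕ
    L = 4 * K
    M : ℕ
    M = proj₁ (g-window-bound L) + L
    negligible : ∀ t → c + D * M ≤ t → K * g t ≤ partialSum t
    negligible t cDM≤t with Q-off-progression t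
    ... | inj₁ Qt≡0 = ≤-trans (≤-reflexive (trans (cong (λ x → K * (t * x)) Qt≡0)
                                 (trans (cong (K *_) (*-zeroʳ t)) (*-zeroʳ K)))) z≤n
    ... | inj₂ (s , refl) = *-cancelˡ-≤ 4 (begin
      4 * (K * g t)                         ≡⟨ sym (*-assoc 4 K (g t)) ⟩
      L * g t                               ≡⟨ sym (Σ-const L (g t)) ⟩
      Σ< L (λ _ → g t)                      ≤⟨ Σ-mono L comparable ⟩
      Σ< L (λ j → 4 * g (t ∸ D * j))        ≡⟨ Σ-*ˡ L 4 (λ j → g (t ∸ D * j)) ⟩
      4 * Σ< L (λ j → g (t ∸ D * j))        ≤⟨ *-monoʳ-≤ 4 (progressionSum≤partialSum d L t DL≤t) ⟩
      4 * partialSum t                      ∎)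
      where
      open ≤-Reasoning
      M≤s : M ≤ s
      M≤s = *-cancelˡ-≤ D (+-cancelˡ-≤ c _ _ cDM≤t)
      L≤s : L ≤ s
      L≤s = ≤-trans (m≤n+m L (proj₁ (g-window-bound L))) M≤s
      DL≤t : D * L ≤ t
      DL≤t = ≤-trans (*-monoʳ-≤ D L≤s) (m≤n+m (D * s) c)
      comparable : ∀ j → j < L → g t ≤ 4 * g (t ∸ D * j)
      comparable j j<L = subst (λ x → g t ≤ 4 * g x) (sym (step-back s j (≤-trans (<⇒≤ j<L) L≤s)))
                           (proj₂ (g-window-bound L) s (≤-trans (m≤m+n _ L) M≤s) j j<L)

  progression-floor : ∀ n → c ≤ n → n ≡ (c + D * ((n ∸ c) / D)) + (n ∸ c) % D
  progression-floor n c≤n = begin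
    n                                        ≡⟨ sym (m+[n∸m]≡n c≤n) ⟩
    c + (n ∸ c)                              ≡⟨ cong (c +_) (m≡m%n+[m/n]*n (n ∸ c) D) ⟩
    c + ((n ∸ c) % D + (n ∸ c) / D * D)      ≡⟨ solve 4 (λ c r s D → c :+ (r :+ s :* D) := (c :+ D :* s) :+ r) refl c ((n ∸ c) % D) ((n ∸ c) / D) D ⟩
    (c + D * ((n ∸ c) / D)) + (n ∸ c) % D    ∎
    where open ≡-Reasoning

  dense-support : ∀ T → Eventually (λ n → ∃ λ t → T ≤ t × t ≤ n × n ≤ t + t × t ≤ g t)
  dense-support T = c + D * M , nearby
    where
    N₀ : ℕ
    N₀ = proj₁ R-positive
    M : ℕ
    M = suc (N₀ + T)
    nearby : ∀ n → c + D * M ≤ n → ∃ λ t → T ≤ t × t ≤ n × n ≤ t + t × t ≤ g t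
    nearby n cDM≤n = t , T≤t , t≤n , n≤2t , t≤gt
      where
      open ≤-Reasoning
      s : ℕ
      s = (n ∸ c) / D
      t : ℕ
      t = c + D * s
      n≡t+r : n ≡ t + (n ∸ c) % D
      n≡t+r = progression-floor n (≤-trans (m≤m+n c (D * M)) cDM≤n)
      M≤s : M ≤ s
      M≤s = begin
        M                 ≡⟨ sym (trans (cong (_/ D) (*-comm D M)) (m*n/n≡m M D)) ⟩
        D * M / D         ≡⟨ cong (_/ D) (sym (m+n∸m≡n c (D * M))) ⟩
        (c + D * M ∸ c) / D ≤⟨ /-monoˡ-≤ D (∸-monoˡ-≤ c cDM≤n) ⟩
        s                 ∎
      s≤t : s ≤ t
      s≤t = ≤-trans (m≤n*m s D) (m≤n+m (D * s) c)
      T≤t : T ≤ t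
      T≤t = ≤-trans (≤-trans (m≤n+m T N₀) (n≤1+n (N₀ + T))) (≤-trans M≤s s≤t)
      t≤n : t ≤ n
      t≤n = ≤-trans (m≤m+n t _) (≤-reflexive (sym n≡t+r))
      D≤t : D ≤ t
      D≤t = begin
        D         ≡⟨ sym (*-identityʳ D) ⟩
        D * 1     ≤⟨ *-monoʳ-≤ D (≤-trans (s≤s z≤n) M≤s) ⟩
        D * s     ≤⟨ m≤n+m (D * s) c ⟩
        t         ∎
      n≤2t : n ≤ t + t
      n≤2t = ≤-trans (≤-reflexive n≡t+r) (+-monoʳ-≤ t (≤-trans (<⇒≤ (m%n<n (n ∸ c) D)) D≤t))
      t≤gt : t ≤ g t
      t≤gt = begin
        t         ≡⟨ sym (*-identityʳ t) ⟩
        t * 1     ≤⟨ *-monoʳ-≤ t (proj₂ R-positive s (≤-trans (≤-trans (m≤m+n N₀ T) (n≤1+n (N₀ + T))) M≤s)) ⟩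
        t * R s   ≡⟨ cong (t *_) (sym (Q-on-progression s)) ⟩
        g t       ∎

  divSum-negligible-for-progression : ∀ K → Eventually (λ n → K * divSum n < cumSum n)
  divSum-negligible-for-progression =
    divSum-negligible g-negligible (cumSum-superlinear g-negligible dense-support)

module RationalEmbedding where

  open import Data.Integer as ℤ using (+_)
  import Data.Integer.Properties as ℤₚ
  import Data.Nat.Properties as ℕₚ
  import Data.Nat.Coprimality as Coprimality
  open import Data.Rational
  open import Data.Rational.Properties
  import Data.Rational.Unnormalised as ℚᵘ
  import Data.Rational.Unnormalised.Properties as ℚᵘ
  open import Relation.Binary.PropositionalEquality
  open import Data.Integer.Solver using () renaming (module +-*-Solver to ℤ-Solver)
  open import Data.Nat.Solver using () renaming (module +-*-Solver to ℕ-Solver)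

  ι : ℕ → ℚ
  ι n = mkℚ (+ n) 0 (Coprimality.sym (Coprimality.1-coprimeTo n))

  /1≡ι : ∀ n → (+ n) / 1 ≡ ι n
  /1≡ι n = ↥p/↧p≡p (ι n)

  ι-+ : ∀ m n → ι m + ι n ≡ ι (m ℕ.+ n)
  ι-+ m n = toℚᵘ-injective (ℚᵘ.≃-trans (toℚᵘ-homo-+ (ι m) (ι n)) (ℚᵘ.*≡* numerators))
    where
    open ℤ-Solver
    numerators : (+ m ℤ.* + 1 ℤ.+ + n ℤ.* + 1) ℤ.* + 1 ≡ + (m ℕ.+ n) ℤ.* + 1
    numerators rewrite ℤₚ.pos-+ m n =
      solve 2 (λ a b → (a :* con (+ 1) :+ b :* con (+ 1)) :* con (+ 1) := (a :+ b) :* con (+ 1)) refl (+ m) (+ n)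

  ι-mono-< : ∀ {m n} → m ℕ.< n → ι m < ι n
  ι-mono-< {m} {n} m<n = *<* (subst₂ ℤ._<_ (sym (ℤₚ.*-identityʳ (+ m))) (sym (ℤₚ.*-identityʳ (+ n))) (ℤ.+<+ m<n))

  ι-cancel-< : ∀ {m n} → ι m < ι n → m ℕ.< n
  ι-cancel-< {m} {n} ιm<ιn = ℤₚ.drop‿+<+ (subst₂ ℤ._<_ (ℤₚ.*-identityʳ (+ m)) (ℤₚ.*-identityʳ (+ n)) (drop-*<* ιm<ιn))

  ι-cancel-denominator : ∀ u m x → ι (u ℕ.* suc m) * ((+ x) / suc m) ≡ ι (u ℕ.* x)
  ι-cancel-denominator u m x = toℚᵘ-injective (ℚᵘ.≃-trans (toℚᵘ-homo-* (ι (u ℕ.* suc m)) ((+ x) / suc m))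
     (ℚᵘ.≃-trans (ℚᵘ.*-congˡ {toℚᵘ (ι (u ℕ.* suc m))} (toℚᵘ-fromℚᵘ (ℚᵘ.mkℚᵘ (+ x) m))) (ℚᵘ.*≡* cross)))
    where
    cross : (+ (u ℕ.* suc m) ℤ.* + x) ℤ.* + 1 ≡ + (u ℕ.* x) ℤ.* + (1 ℕ.* suc m)
    cross = begin
      (+ (u ℕ.* suc m) ℤ.* + x) ℤ.* + 1 ≡⟨ ℤₚ.*-identityʳ _ ⟩
      + (u ℕ.* suc m) ℤ.* + x           ≡⟨ sym (ℤₚ.pos-* (u ℕ.* suc m) x) ⟩
      + (u ℕ.* suc m ℕ.* x)             ≡⟨ cong +_ reorder ⟩
      + (u ℕ.* x ℕ.* (1 ℕ.* suc m))     ≡⟨ ℤₚ.pos-* (u ℕ.* x) (1 ℕ.* suc m) ⟩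
      + (u ℕ.* x) ℤ.* + (1 ℕ.* suc m)   ∎
      where
      open ≡-Reasoning
      open ℕ-Solver
      reorder : u ℕ.* suc m ℕ.* x ≡ u ℕ.* x ℕ.* (1 ℕ.* suc m)
      reorder = solve 3 (λ u s x → u :* s :* x := u :* x :* (con 1 :* s)) refl u (suc m) x

  fraction-toℚᵘ : ∀ k h → toℚᵘ (ι k * 1/ ι (suc h)) ℚᵘ.≃ ℚᵘ.mkℚᵘ (+ k) h
  fraction-toℚᵘ k h = ℚᵘ.≃-trans (toℚᵘ-homo-* (ι k) (1/ ι (suc h)))
                        (ℚᵘ.*≡* (cong₂ ℤ._*_ (ℤₚ.*-identityʳ (+ k)) (cong +_ (sym (ℕₚ.*-identityˡ (suc h))))))

-- The coefficients of Q̂ are the naturals H n = a 1 + … + a n embedded in ℚ: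
-- the n-th coefficient of the derivative of Q⋆ is (n+1)·Σ_{e ∣ n+1} q((n+1)/e)/e = a(n+1).
module HatCoefficients (Q : NSeries) where

  open import Data.Nat.DivMod using (_%_; m/n*n≡m) renaming (_/_ to _div_)
  open import Data.Nat.Divisibility using (m%n≡0⇒n∣m)
  open import Data.Integer using (+_)
  open import Data.Rational
  open import Data.Rational.Properties
  open import Relation.Binary.PropositionalEquality
  open import Relation.Nullary using (yes; no)
  open NaturalSums using (Σ<)
  open StarCoefficients Q
  open RationalEmbedding

  sumBelow-cong : ∀ n {f g} → (∀ i → f i ≡ g i) → sumBelow n f ≡ sumBelow n g
  sumBelow-cong zero    f≡g = refl
  sumBelow-cong (suc n) f≡g = cong₂ _+_ (sumBelow-cong n f≡g) (f≡g n)

  sumBelow-*ˡ : ∀ n x f → x * sumBelow n f ≡ sumBelow n (λ i → x * f i)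
  sumBelow-*ˡ zero    x f = *-zeroʳ x
  sumBelow-*ˡ (suc n) x f = trans (*-distribˡ-+ x (sumBelow n f) (f n)) (cong (_+ x * f n) (sumBelow-*ˡ n x f))

  sumBelow-ι : ∀ n f → sumBelow n (λ i → ι (f i)) ≡ ι (Σ< n f)
  sumBelow-ι zero    f = refl
  sumBelow-ι (suc n) f = trans (cong (_+ ι (f n)) (sumBelow-ι n f)) (ι-+ (Σ< n f) (f n))

  ι*starCoeffTerm : ∀ j m → ι j * starCoeffTerm Q j m ≡ ι (divTerm j m)
  ι*starCoeffTerm j m with j % suc m ℕ.≟ 0
  ... | yes divides = trans (cong (λ v → ι v * ((+ Q (j div suc m)) / suc m)) (sym (m/n*n≡m (m%n≡0⇒n∣m j (suc m) divides))))
                            (ι-cancel-denominator (j div suc m) m (Q (j div suc m)))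
  ... | no  _       = *-zeroʳ (ι j)

  deriv-star : ∀ k → deriv (star Q) k ≡ ι (divSum (suc k))
  deriv-star k = begin
    ((+ suc k) / 1) * star Q (suc k)                               ≡⟨ cong (_* star Q (suc k)) (/1≡ι (suc k)) ⟩
    ι (suc k) * sumBelow (suc k) (starCoeffTerm Q (suc k))         ≡⟨ sumBelow-*ˡ (suc k) (ι (suc k)) _ ⟩
    sumBelow (suc k) (λ m → ι (suc k) * starCoeffTerm Q (suc k) m) ≡⟨ sumBelow-cong (suc k) (ι*starCoeffTerm (suc k)) ⟩
    sumBelow (suc k) (λ m → ι (divTerm (suc k) m))                 ≡⟨ sumBelow-ι (suc k) (divTerm (suc k)) ⟩
    ι (divSum (suc k))                                             ∎
    where open ≡-Reasoning

  hat≡cumSum : ∀ n → hat Q n ≡ ι (cumSum n)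
  hat≡cumSum n = trans (sumBelow-cong n deriv-star) (sumBelow-ι n (λ k → divSum (suc k)))

module RatioBridge where

  import Data.Nat.Properties as ℕₚ
  open import Data.Integer as ℤ using (+_; +0; +[1+_]; -[1+_])
  import Data.Integer.Properties as ℤₚ
  open import Data.Rational
  open import Data.Rational.Properties
  import Data.Rational.Unnormalised as ℚᵘ
  import Data.Rational.Unnormalised.Properties as ℚᵘ
  open import Data.Product using (∃; _,_; proj₁; proj₂)
  open import Relation.Binary.PropositionalEquality
  open import Relation.Nullary using (yes; no)
  import Data.Rational.Solver as ℚ-Solver
  open ℚ-Solver.+-*-Solver
  open RationalEmbedding

  ratio-deviation : ∀ h' k h → h' ℕ.+ k ≡ suc h → ∣ ι h' ⊘ ι (suc h) - 1ℚ ∣ ≡ ι k * 1/ ι (suc h)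
  ratio-deviation h' k h h'+k≡h+1 = begin
    ∣ ι h' * w - 1ℚ ∣                 ≡⟨ cong (λ v → ∣ ι h' * w - v ∣) (sym (*-inverseʳ (ι (suc h)))) ⟩
    ∣ ι h' * w - ι (suc h) * w ∣      ≡⟨ cong (λ v → ∣ ι h' * w - v * w ∣) (trans (cong ι (sym h'+k≡h+1)) (sym (ι-+ h' k))) ⟩
    ∣ ι h' * w - (ι h' + ι k) * w ∣   ≡⟨ cong ∣_∣ (solve 3 (λ p q r → p :* r :- (p :+ q) :* r := :- (q :* r)) refl (ι h') (ι k) w) ⟩
    ∣ - (ι k * w) ∣                   ≡⟨ ∣-p∣≡∣p∣ (ι k * w) ⟩
    ∣ ι k * w ∣                       ≡⟨ 0≤p⇒∣p∣≡p (nonNegative⁻¹ (ι k * w) {{nonNeg*nonNeg⇒nonNeg (ι k) w}}) ⟩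
    ι k * w                           ∎
    where
    open ≡-Reasoning
    w : ℚ
    w = 1/ ι (suc h)

  fraction<⇒cross : ∀ k h q → ι k * 1/ ι (suc h) < q → + k ℤ.* ↧ q ℤ.< ↥ q ℤ.* + suc h
  fraction<⇒cross k h q@record{} k/h+1<q =
    ℚᵘ.drop-*<* (ℚᵘ.<-respˡ-≃ (fraction-toℚᵘ k h) (toℚᵘ-mono-< k/h+1<q))

  cross⇒fraction< : ∀ k h q → + k ℤ.* ↧ q ℤ.< ↥ q ℤ.* + suc h → ι k * 1/ ι (suc h) < q
  cross⇒fraction< k h q@record{} cross =
    toℚᵘ-cancel-< (ℚᵘ.<-respˡ-≃ (ℚᵘ.≃-sym (fraction-toℚᵘ k h)) (ℚᵘ.*<* cross))

  near-one⇒ratio-bound : ∀ M x y → 1 ℕ.≤ y → ∣ ι x ⊘ ι y - 1ℚ ∣ < 1/ ι (suc M) → M ℕ.* y ℕ.≤ suc M ℕ.* x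
  near-one⇒ratio-bound M x (suc h) _ close with suc h ℕ.≤? x
  ... | yes y≤x = ℕₚ.≤-trans (ℕₚ.*-monoʳ-≤ M y≤x) (ℕₚ.m≤n+m (M ℕ.* x) x)
  ... | no  y≰x = begin
    M ℕ.* suc h         ≡⟨ cong (M ℕ.*_) (sym x+k≡y) ⟩
    M ℕ.* (x ℕ.+ k)     ≡⟨ ℕₚ.*-distribˡ-+ M x k ⟩
    M ℕ.* x ℕ.+ M ℕ.* k ≤⟨ ℕₚ.+-monoʳ-≤ (M ℕ.* x) Mk≤x ⟩
    M ℕ.* x ℕ.+ x       ≡⟨ ℕₚ.+-comm (M ℕ.* x) x ⟩
    suc M ℕ.* x         ∎
    where
    open ℕₚ.≤-Reasoning
    k : ℕ
    k = suc h ℕ.∸ x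
    x+k≡y : x ℕ.+ k ≡ suc h
    x+k≡y = ℕₚ.m+[n∸m]≡n (ℕₚ.<⇒≤ (ℕₚ.≰⇒> y≰x))
    k/y<1/[M+1] : ι k * 1/ ι (suc h) < 1/ ι (suc M)
    k/y<1/[M+1] = subst (_< 1/ ι (suc M)) (ratio-deviation x k h x+k≡y) close
    k[M+1]<y : k ℕ.* suc M ℕ.< suc h
    k[M+1]<y = ℤₚ.drop‿+<+ (subst₂ ℤ._<_ (sym (ℤₚ.pos-* k (suc M))) (ℤₚ.*-identityˡ (+ suc h))
                 (fraction<⇒cross k h (1/ ι (suc M)) k/y<1/[M+1]))
    Mk≤x : M ℕ.* k ℕ.≤ x
    Mk≤x = ℕₚ.<⇒≤ (ℕₚ.+-cancelˡ-< k (M ℕ.* k) x (begin-strict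
      k ℕ.+ M ℕ.* k   ≡⟨ cong (k ℕ.+_) (ℕₚ.*-comm M k) ⟩
      k ℕ.+ k ℕ.* M   ≡⟨ sym (ℕₚ.*-suc k M) ⟩
      k ℕ.* suc M     <⟨ k[M+1]<y ⟩
      suc h           ≡⟨ sym x+k≡y ⟩
      x ℕ.+ k         ≡⟨ ℕₚ.+-comm x k ⟩
      k ℕ.+ x         ∎))

  positive-numerator : ∀ ε → 0ℚ < ε → ∃ λ p-1 → ↥ ε ≡ +[1+ p-1 ]
  positive-numerator (mkℚ +[1+ p-1 ] _ _) _   = p-1 , refl
  positive-numerator (mkℚ +0 _ _)        ε>0 with ℤ.+<+ () ← ℤₚ.positive⁻¹ +0 {{positive ε>0}}
  positive-numerator (mkℚ -[1+ n ] _ _)  ε>0 with () ← ℤₚ.positive⁻¹ -[1+ n ] {{positive ε>0}}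

  small-increment⇒near-one : ∀ ε → 0ℚ < ε → ∀ h' k h → h' ℕ.+ k ≡ suc h → ↧ₙ ε ℕ.* k ℕ.< suc h →
                             ∣ ι h' ⊘ ι (suc h) - 1ℚ ∣ < ε
  small-increment⇒near-one ε ε>0 h' k h h'+k≡h+1 qk<h+1 =
    subst (_< ε) (sym (ratio-deviation h' k h h'+k≡h+1)) (cross⇒fraction< k h ε cross)
    where
    open ℤₚ.≤-Reasoning
    1≤p : + 1 ℤ.≤ ↥ ε
    1≤p = subst (+ 1 ℤ.≤_) (sym (proj₂ (positive-numerator ε ε>0))) (ℤ.+≤+ (ℕ.s≤s ℕ.z≤n))
    cross : + k ℤ.* ↧ ε ℤ.< ↥ ε ℤ.* + suc h
    cross = begin-strict
      + k ℤ.* ↧ ε       ≡⟨ sym (ℤₚ.pos-* k (↧ₙ ε)) ⟩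
      + (k ℕ.* ↧ₙ ε)    <⟨ ℤ.+<+ (subst (ℕ._< suc h) (ℕₚ.*-comm (↧ₙ ε) k) qk<h+1) ⟩
      + suc h           ≡⟨ sym (ℤₚ.*-identityˡ (+ suc h)) ⟩
      + 1 ℤ.* + suc h   ≤⟨ ℤₚ.*-monoʳ-≤-nonNeg (+ suc h) 1≤p ⟩
      ↥ ε ℤ.* + suc h   ∎

  negligible-increments⇒RT₁ : ∀ (r : Series) (H a : ℕ → ℕ) → (∀ n → r n ≡ ι (H n)) →
    (∀ n → H (suc n) ≡ H n ℕ.+ a (suc n)) → (∀ K → Eventually (λ n → K ℕ.* a n ℕ.< H n)) → RT₁ r
  negligible-increments⇒RT₁ r H a r≡ι∘H H-step a-negligible = eventually-positive , ratio→1
    where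
    eventually-positive : Eventually (λ n → 0ℚ < r n)
    eventually-positive = proj₁ (a-negligible 0) , λ n N≤n →
      subst (0ℚ <_) (sym (r≡ι∘H n)) (ι-mono-< (proj₂ (a-negligible 0) n N≤n))
    ratio→1 : ConvergesTo (λ n → r (n ℕ.∸ 1) ⊘ r n) 1ℚ
    ratio→1 ε ε>0 = suc N , close
      where
      N : ℕ
      N = proj₁ (a-negligible (↧ₙ ε))
      close : ∀ n → suc N ℕ.≤ n → ∣ r (n ℕ.∸ 1) ⊘ r n - 1ℚ ∣ < ε
      close (suc m) (ℕ.s≤s N≤m) =
        subst₂ (λ u v → ∣ u ⊘ v - 1ℚ ∣ < ε) (sym (r≡ι∘H m)) (trans (cong ι (sym H≡h+1)) (sym (r≡ι∘H (suc m))))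
          (small-increment⇒near-one ε ε>0 (H m) (a (suc m)) h (trans (sym (H-step m)) H≡h+1)
            (subst (↧ₙ ε ℕ.* a (suc m) ℕ.<_) H≡h+1 qa<H))
        where
        qa<H : ↧ₙ ε ℕ.* a (suc m) ℕ.< H (suc m)
        qa<H = proj₂ (a-negligible (↧ₙ ε)) (suc m) (ℕₚ.≤-trans N≤m (ℕₚ.n≤1+n m))
        h : ℕ
        h = ℕ.pred (H (suc m))
        H≡h+1 : H (suc m) ≡ suc h
        H≡h+1 = sym (ℕₚ.suc-pred (H (suc m)) {{ℕ.>-nonZero (ℕₚ.≤-<-trans ℕ.z≤n qa<H)}})

  RTN₁⇒eventually-positive : ∀ R → RTN₁ R → Eventually (λ s → 1 ℕ.≤ R s)
  RTN₁⇒eventually-positive R ((N , R>0) , _) =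
    N , λ s N≤s → ι-cancel-< (subst (0ℚ <_) (/1≡ι (R s)) (R>0 s N≤s))

  RTN₁⇒ratio-bound : ∀ R → RTN₁ R → RatioBounded R
  RTN₁⇒ratio-bound R ((N₀ , R>0) , ratio→1) M = N₁ ℕ.+ N₀ , bound
    where
    close-to-1 : ∃ λ N → ∀ n → N ℕ.≤ n → ∣ toℚSeries R (n ℕ.∸ 1) ⊘ toℚSeries R n - 1ℚ ∣ < 1/ ι (suc M)
    close-to-1 = ratio→1 (1/ ι (suc M)) (positive⁻¹ (1/ ι (suc M)))
    N₁ : ℕ
    N₁ = proj₁ close-to-1
    bound : ∀ n → N₁ ℕ.+ N₀ ℕ.≤ n → M ℕ.* R n ℕ.≤ suc M ℕ.* R (n ℕ.∸ 1)
    bound n N≤n = near-one⇒ratio-bound M (R (n ℕ.∸ 1)) (R n)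
      (ι-cancel-< (subst (0ℚ <_) (/1≡ι (R n)) (R>0 n (ℕₚ.≤-trans (ℕₚ.m≤n+m N₀ N₁) N≤n))))
      (subst₂ (λ u v → ∣ u ⊘ v - 1ℚ ∣ < 1/ ι (suc M)) (/1≡ι (R (n ℕ.∸ 1))) (/1≡ι (R n))
        (proj₂ close-to-1 n (ℕₚ.≤-trans (ℕₚ.m≤m+n N₁ N₀) N≤n)))

open StarCoefficients using (divSum; cumSum)
open HatCoefficients using (hat≡cumSum)
open RatioBridge

lemma4p9 : (Q : NSeries) → In𝔔 Q → RT₁ (hat Q)
lemma4p9 Q (_ , c , zero , R , _ , () , _)
lemma4p9 Q (_ , c , suc d , R , R∈RTN₁ , _ , Q≡) =
  negligible-increments⇒RT₁ (hat Q) (cumSum Q) (divSum Q) (hat≡cumSum Q) (λ _ → refl)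
    divSum-negligible-for-progression
  where
  open Progression c d R Q Q≡ (RTN₁⇒eventually-positive R R∈RTN₁) (RTN₁⇒ratio-bound R R∈RTN₁)
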